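{- Let $P$ be a prime with $P\equiv 1\pmod 4$. Fix $\gamma\in\mathbb{N}$ with $\gamma\equiv 3\pmod 4$, and set $c=\frac{\gamma P+1}{4}$, with $\gcd(\gamma,c)=1$. Then every pair $u,v\in\mathbb{N}$ satisfying \[ uv=c^2,\qquad u\equiv v\equiv -c\pmod{\gamma} \] yields a solution \[ \frac{4}{P}=\frac1A+\frac1B+\frac1C,\qquad A=\frac{u+c}{\gamma},\quad B=\frac{v+c}{\gamma},\quad C=cP. \] Conversely, every solution $(A,B,C)$ in positive integers of $\frac4P=\frac1A+\frac1B+\frac1C$ with $C=cP$, $P\nmid A$ and $P\nmid B$ is obtained in this way. Moreover, $A\le B$ if and only if $u\le v$. -}

module Defs where

open import Data.Nat using (ℕ; _+_; _*_; _<_)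
open import Data.Product using (_×_)
open import Relation.Binary.PropositionalEquality using (_≡_)

-- (A , B , C) is a solution in positive integers of  4/P = 1/A + 1/B + 1/C.
-- For P > 0 and A, B, C > 0 this is equivalent (multiply by P*A*B*C) to the
-- cleared-denominator equation  4*A*B*C = P*(B*C + A*C + A*B).
EgyptianSol : ℕ → ℕ → ℕ → ℕ → Set
EgyptianSol P A B C =
  (0 < A) × (0 < B) × (0 < C) ×
  (4 * A * B * C ≡ P * (B * C + A * C + A * B))

{-# OPTIONS --safe #-}
-- Since 4c − 1 = γP, we have 4/P − 1/(cP) = γ/c, so a solution with C = cP is
-- exactly a pair with 1/A + 1/B = γ/c, i.e. γAB = c(A + B).  Substituting
-- γA = u + c and γB = v + c turns this into (u + c)(v + c) = c(u + c) + c(v + c),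
-- which is uv = c².  The order statement holds because A ↦ γA − c is monotone.
module Submission where

open import Defs
open import Data.List using ([]; _∷_)
open import Data.Nat using (ℕ; _+_; _*_; _∸_; _%_; _≤_; _<_; NonZero; >-nonZero)
open import Data.Nat.DivMod using (_/_; /-congˡ; m*n/n≡m; m*[n/m]≡n)
open import Data.Nat.Divisibility using (_∣_; m∣m*n)
open import Data.Nat.Primality using (Prime; prime⇒nonZero)
open import Data.Nat.Coprimality using (Coprime)
open import Data.Nat.Properties
open import Data.Nat.Tactic.RingSolver using (solve)
open import Data.Product using (_×_; ∃-syntax; _,_)
open import Function.Bundles using (_⇔_; mk⇔; Equivalence)
open import Relation.Nullary using (¬_)
open import Relation.Binary.PropositionalEquality

open ≡-Reasoning

EgyptianEquation : ℕ → ℕ → ℕ → ℕ → Set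
EgyptianEquation P A B C = 4 * A * B * C ≡ P * (B * C + A * C + A * B)

ReciprocalSum : ℕ → ℕ → ℕ → ℕ → Set
ReciprocalSum γ c A B = γ * A * B ≡ c * (A + B)

reciprocalSum-sym : ∀ {γ c A B} → ReciprocalSum γ c A B → ReciprocalSum γ c B A
reciprocalSum-sym {γ} {c} {A} {B} eq = begin
  γ * B * A   ≡⟨ solve (γ ∷ A ∷ B ∷ []) ⟩
  γ * A * B   ≡⟨ eq ⟩
  c * (A + B) ≡⟨ cong (c *_) (+-comm A B) ⟩
  c * (B + A) ∎

reciprocalSum⇒c≤γ* : ∀ {γ c A B} → 0 < B → ReciprocalSum γ c A B → c ≤ γ * A
reciprocalSum⇒c≤γ* {γ} {c} {A} {B} B>0 eq = *-cancelʳ-≤ c (γ * A) B {{>-nonZero B>0}}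
  (≤-trans (m≤n+m (c * B) (c * A)) (≤-reflexive (sym (trans eq (*-distribˡ-+ c A B)))))

n≡m*q⇒n/m≡q : ∀ {m n q} .{{_ : NonZero m}} → n ≡ m * q → n / m ≡ q
n≡m*q⇒n/m≡q {m} {n} {q} n≡m*q = trans (/-congˡ (trans n≡m*q (*-comm m q))) (m*n/n≡m q m)

shifted-positive : ∀ γ u {c a} → 0 < c → u + c ≡ γ * a → 0 < a
shifted-positive γ u c>0 u+c≡γa = n≢0⇒n>0 λ a≡0 →
  n>0⇒n≢0 c>0 (m+n≡0⇒n≡0 u (trans u+c≡γa (trans (cong (γ *_) a≡0) (*-zeroʳ γ))))

module _ (γ c u v : ℕ) {a b : ℕ} (u+c≡γa : u + c ≡ γ * a) (v+c≡γb : v + c ≡ γ * b) where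

  γ*reciprocalSum-expansion : γ * (γ * a * b) + c * c ≡ u * v + γ * (c * (a + b))
  γ*reciprocalSum-expansion = begin
    γ * (γ * a * b) + c * c                ≡⟨ solve (γ ∷ a ∷ b ∷ c ∷ []) ⟩
    (γ * a) * (γ * b) + c * c              ≡⟨ cong₂ (λ x y → x * y + c * c) u+c≡γa v+c≡γb ⟨
    (u + c) * (v + c) + c * c              ≡⟨ solve (u ∷ v ∷ c ∷ []) ⟩
    u * v + (c * (u + c) + c * (v + c))    ≡⟨ cong₂ (λ x y → u * v + (c * x + c * y)) u+c≡γa v+c≡γb ⟩
    u * v + (c * (γ * a) + c * (γ * b))    ≡⟨ cong (u * v +_) (solve (γ ∷ a ∷ b ∷ c ∷ [])) ⟩
    u * v + γ * (c * (a + b))              ∎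

  *≡square⇔reciprocalSum : .{{_ : NonZero γ}} → (u * v ≡ c * c) ⇔ ReciprocalSum γ c a b
  *≡square⇔reciprocalSum = mk⇔ to from
    where
    to : u * v ≡ c * c → ReciprocalSum γ c a b
    to uv≡c² = *-cancelˡ-≡ _ _ γ (+-cancelʳ-≡ (c * c) _ _ (begin
      γ * (γ * a * b) + c * c       ≡⟨ γ*reciprocalSum-expansion ⟩
      u * v + γ * (c * (a + b))     ≡⟨ cong (_+ γ * (c * (a + b))) uv≡c² ⟩
      c * c + γ * (c * (a + b))     ≡⟨ +-comm (c * c) _ ⟩
      γ * (c * (a + b)) + c * c     ∎))
    from : ReciprocalSum γ c a b → u * v ≡ c * c
    from eq = +-cancelʳ-≡ (γ * (c * (a + b))) _ _ (begin
      u * v + γ * (c * (a + b))     ≡⟨ γ*reciprocalSum-expansion ⟨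
      γ * (γ * a * b) + c * c       ≡⟨ cong (λ x → γ * x + c * c) eq ⟩
      γ * (c * (a + b)) + c * c     ≡⟨ +-comm _ (c * c) ⟩
      c * c + γ * (c * (a + b))     ∎)

  shifted-≤⇔ : .{{_ : NonZero γ}} → (a ≤ b) ⇔ (u ≤ v)
  shifted-≤⇔ = mk⇔
    (λ a≤b → +-cancelʳ-≤ c u v (subst₂ _≤_ (sym u+c≡γa) (sym v+c≡γb) (*-monoʳ-≤ γ a≤b)))
    (λ u≤v → *-cancelˡ-≤ γ (subst₂ _≤_ u+c≡γa v+c≡γb (+-monoˡ-≤ c u≤v)))

module _ {P γ c : ℕ} (4c≡γP+1 : 4 * c ≡ γ * P + 1) where

  c>0 : 0 < c
  c>0 = n≢0⇒n>0 λ { refl → m+1+n≢0 (γ * P) (sym 4c≡γP+1) }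

  γ*egyptianLhs : ∀ A B → γ * (4 * A * B * (c * P)) ≡ P * (γ * P * (γ * A * B) + γ * A * B)
  γ*egyptianLhs A B = begin
    γ * (4 * A * B * (c * P))               ≡⟨ solve (γ ∷ A ∷ B ∷ c ∷ P ∷ []) ⟩
    4 * c * (γ * A * B * P)                 ≡⟨ cong (_* (γ * A * B * P)) 4c≡γP+1 ⟩
    (γ * P + 1) * (γ * A * B * P)           ≡⟨ solve (γ ∷ A ∷ B ∷ P ∷ []) ⟩
    P * (γ * P * (γ * A * B) + γ * A * B)   ∎

  γ*egyptianRhs : ∀ A B → γ * (P * (B * (c * P) + A * (c * P) + A * B))
                          ≡ P * (γ * P * (c * (A + B)) + γ * A * B)
  γ*egyptianRhs A B = solve (γ ∷ A ∷ B ∷ c ∷ P ∷ [])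

  egyptianEquation-cP⇔reciprocalSum : .{{_ : NonZero P}} .{{_ : NonZero γ}} → ∀ A B →
    EgyptianEquation P A B (c * P) ⇔ ReciprocalSum γ c A B
  egyptianEquation-cP⇔reciprocalSum A B = mk⇔ to from
    where
    to : EgyptianEquation P A B (c * P) → ReciprocalSum γ c A B
    to eq = *-cancelˡ-≡ _ _ (γ * P) {{m*n≢0 γ P}}
      (+-cancelʳ-≡ (γ * A * B) _ _
        (*-cancelˡ-≡ _ _ P
          (trans (sym (γ*egyptianLhs A B)) (trans (cong (γ *_) eq) (γ*egyptianRhs A B)))))
    from : ReciprocalSum γ c A B → EgyptianEquation P A B (c * P)
    from eq = *-cancelˡ-≡ _ _ γ (begin
      γ * (4 * A * B * (c * P))                ≡⟨ γ*egyptianLhs A B ⟩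
      P * (γ * P * (γ * A * B) + γ * A * B)    ≡⟨ cong (λ x → P * (γ * P * x + γ * A * B)) eq ⟩
      P * (γ * P * (c * (A + B)) + γ * A * B)  ≡⟨ γ*egyptianRhs A B ⟨
      γ * (P * (B * (c * P) + A * (c * P) + A * B)) ∎)

  egyptianSol-cP⇔reciprocalSum : .{{_ : NonZero P}} .{{_ : NonZero γ}} → ∀ A B →
    EgyptianSol P A B (c * P) ⇔ (0 < A × 0 < B × ReciprocalSum γ c A B)
  egyptianSol-cP⇔reciprocalSum A B = mk⇔
    (λ (A>0 , B>0 , _ , eq) → A>0 , B>0 , to eq)
    (λ (A>0 , B>0 , eq) → A>0 , B>0 , <-≤-trans c>0 (m≤m*n c P) , from eq)
    where open Equivalence (egyptianEquation-cP⇔reciprocalSum A B)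

  egyptianSol-fromFactorisation : .{{_ : NonZero P}} .{{_ : NonZero γ}} → ∀ u v →
    u * v ≡ c * c → γ ∣ u + c → γ ∣ v + c →
    EgyptianSol P ((u + c) / γ) ((v + c) / γ) (c * P)
  egyptianSol-fromFactorisation u v uv≡c² γ∣u+c γ∣v+c =
    Equivalence.from (egyptianSol-cP⇔reciprocalSum _ _)
      ( shifted-positive γ u c>0 u+c≡γa
      , shifted-positive γ v c>0 v+c≡γb
      , Equivalence.to (*≡square⇔reciprocalSum γ c u v u+c≡γa v+c≡γb) uv≡c²)
    where
    u+c≡γa : u + c ≡ γ * ((u + c) / γ)
    u+c≡γa = sym (m*[n/m]≡n γ∣u+c)
    v+c≡γb : v + c ≡ γ * ((v + c) / γ)
    v+c≡γb = sym (m*[n/m]≡n γ∣v+c)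

  factorisation-fromEgyptianSol : .{{_ : NonZero P}} .{{_ : NonZero γ}} → ∀ A B →
    EgyptianSol P A B (c * P) →
    ∃[ u ] ∃[ v ] (u * v ≡ c * c × γ ∣ u + c × γ ∣ v + c × A ≡ (u + c) / γ × B ≡ (v + c) / γ)
  factorisation-fromEgyptianSol A B sol
    with A>0 , B>0 , eq ← Equivalence.to (egyptianSol-cP⇔reciprocalSum A B) sol =
    u , v , Equivalence.from (*≡square⇔reciprocalSum γ c u v u+c≡γA v+c≡γB) eq
      , subst (γ ∣_) (sym u+c≡γA) (m∣m*n A) , subst (γ ∣_) (sym v+c≡γB) (m∣m*n B)
      , sym (n≡m*q⇒n/m≡q u+c≡γA) , sym (n≡m*q⇒n/m≡q v+c≡γB)
    where
    u v : ℕ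
    u = γ * A ∸ c
    v = γ * B ∸ c
    u+c≡γA : u + c ≡ γ * A
    u+c≡γA = m∸n+n≡m (reciprocalSum⇒c≤γ* {γ} {c} B>0 eq)
    v+c≡γB : v + c ≡ γ * B
    v+c≡γB = m∸n+n≡m (reciprocalSum⇒c≤γ* {γ} {c} A>0 (reciprocalSum-sym {γ} {c} eq))

quotient-≤⇔ : ∀ γ c u v .{{_ : NonZero γ}} → γ ∣ u + c → γ ∣ v + c →
  ((u + c) / γ ≤ (v + c) / γ) ⇔ (u ≤ v)
quotient-≤⇔ γ c u v γ∣u+c γ∣v+c =
  shifted-≤⇔ γ c u v (sym (m*[n/m]≡n γ∣u+c)) (sym (m*[n/m]≡n γ∣v+c))

theorem6p1 : (P γ c : ℕ) → .{{_ : NonZero γ}} →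
    Prime P → P % 4 ≡ 1 → γ % 4 ≡ 3 → 4 * c ≡ γ * P + 1 → Coprime γ c →
    ((u v : ℕ) → u * v ≡ c * c → γ ∣ u + c → γ ∣ v + c →
        EgyptianSol P ((u + c) / γ) ((v + c) / γ) (c * P))
    × ((A B : ℕ) → EgyptianSol P A B (c * P) → ¬ (P ∣ A) → ¬ (P ∣ B) →
        ∃[ u ] ∃[ v ] (u * v ≡ c * c × γ ∣ u + c × γ ∣ v + c
          × A ≡ (u + c) / γ × B ≡ (v + c) / γ))
    × ((u v : ℕ) → u * v ≡ c * c → γ ∣ u + c → γ ∣ v + c →
        (((u + c) / γ ≤ (v + c) / γ) ⇔ (u ≤ v)))
theorem6p1 P γ c P-prime _ _ 4c≡γP+1 _ =
    egyptianSol-fromFactorisation 4c≡γP+1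
  , (λ A B sol _ _ → factorisation-fromEgyptianSol 4c≡γP+1 A B sol)
  , (λ u v _ → quotient-≤⇔ γ c u v)
  where instance
  P≢0 : NonZero P
  P≢0 = prime⇒nonZero P-prime
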